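{- Let $(y_0,m_0,d_0)\in G_0$. Set $y_c=365\cdot y_0+y_0/4-y_0/100+y_0/400$, $m_c=(153\cdot m_0-457)/5$ and $d_c=d_0$. Then $\rho_0(y_0,m_0,d_0)=y_c+m_c+d_c$.
   Context: For $n,\delta\in\mathbb{Z}$ with $\delta\neq0$, $n/\delta$ and $n\%\delta$ denote Euclidean quotient and remainder ($n=q\delta+s$, $0\le s<|\delta|$); $\cdot$, $/$, $\%$ have equal precedence and associate left to right. $\mathbb{Z}^3$ carries the lexicographic order. A year $y$ is a leap year if ($y\%4=0$ and $y\%100\ne0$) or $y\%400=0$. The Gregorian calendar is $G=\{(y,m,d)\in\mathbb{Z}^3: m\in\{1,\dots,12\},\ 1\le d\le L(y,m)\}$ where $L(y,m)=31$ for $m\in\{1,3,5,7,8,10,12\}$, $L(y,m)=30$ for $m\in\{4,6,9,11\}$, and $L(y,2)=29$ if $y$ is a leap year and $28$ otherwise. Let $P_1:\mathbb{Z}^3\to\mathbb{Z}^3$, $P_1(y,m,d)=(y-\mathbf 1_{\{m\le2\}},\ m+12\cdot\mathbf 1_{\{m\le2\}},\ d-1)$, where $\mathbf 1_{\{P\}}$ is $1$ if $P$ holds and $0$ otherwise. The computational calendar is $G_0=\{P_1(x): x\in G,\ P_1(x)\ge e_0\}$ with $e_0=(0,3,0)$, and $\rho_0:G_0\to\mathbb{Z}$ is $\rho_0(x)=\#\{z\in G_0: e_0\le z<x\}$. -}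

module Defs where

open import Data.Integer using (ℤ; +_; _+_; _-_; _*_; _/_; _%_; _<_; _≤_; _≟_)
open import Data.Bool using (Bool; true; false; if_then_else_; _∧_; _∨_; not)
open import Data.Nat using (ℕ)
import Data.Nat as ℕ
open import Data.Product using (Σ; _×_; _,_)
open import Data.Sum using (_⊎_)
open import Data.List using (List; length)
open import Data.List.Relation.Unary.Unique.Propositional using (Unique)
open import Data.List.Membership.Propositional using (_∈_)
open import Function.Bundles using (_⇔_)
open import Relation.Nullary.Decidable using (⌊_⌋)
open import Relation.Binary.PropositionalEquality using (_≡_)
open import Data.Integer using (_≤?_)

ℤ³ : Set
ℤ³ = ℤ × ℤ × ℤ

_<ₗ_ : ℤ³ → ℤ³ → Set
(a , b , c) <ₗ (a' , b' , c') = a < a' ⊎ (a ≡ a' × (b < b' ⊎ (b ≡ b' × c < c')))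

_≤ₗ_ : ℤ³ → ℤ³ → Set
x ≤ₗ y = x <ₗ y ⊎ x ≡ y

infix 4 _==_
_==_ : ℤ → ℤ → Bool
n == k = ⌊ n ≟ k ⌋

isLeap : ℤ → Bool
isLeap y = (⌊ (y % + 4) ℕ.≟ 0 ⌋ ∧ not ⌊ (y % + 100) ℕ.≟ 0 ⌋) ∨ ⌊ (y % + 400) ℕ.≟ 0 ⌋

-- Month lengths L(y,m) (used only for m ∈ {1,…,12})
L : ℤ → ℤ → ℤ
L y m =
  if (m == + 2) then (if isLeap y then + 29 else + 28)
  else if ((m == + 4) ∨ (m == + 6) ∨ (m == + 9) ∨ (m == + 11)) then + 30
  else + 31

G : ℤ³ → Set
G (y , m , d) = (+ 1 ≤ m × m ≤ + 12) × (+ 1 ≤ d × d ≤ L y m)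

ind≤2 : ℤ → ℤ
ind≤2 m = if ⌊ m ≤? + 2 ⌋ then + 1 else + 0

P₁ : ℤ³ → ℤ³
P₁ (y , m , d) = (y - ind≤2 m , m + + 12 * ind≤2 m , d - + 1)

e₀ : ℤ³
e₀ = (+ 0 , + 3 , + 0)

G₀ : ℤ³ → Set
G₀ z = Σ ℤ³ λ x → G x × P₁ x ≡ z × e₀ ≤ₗ P₁ x

-- "The set {z | P z} is finite with exactly n elements":
-- a duplicate-free list enumerating exactly the z with P z, of length n.
HasCard : (ℤ³ → Set) → ℤ → Set
HasCard P n = Σ (List ℤ³) λ l → Unique l × (∀ z → (z ∈ l) ⇔ P z) × + length l ≡ n

-- The predicate defining ρ₀(x) = #{ z ∈ G₀ : e₀ ≤ z < x }
ρ₀-set : ℤ³ → ℤ³ → Set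
ρ₀-set x z = G₀ z × e₀ ≤ₗ z × z <ₗ x

module Submission where

-- Write a computational date with natural coordinates (a, b, c): year a, month b ∈ {3, …, 14},
-- day c counted from 0. The dates before (y, m, d) are then the whole years a < y, the months
-- 3 ≤ b < m of year y and the days c < d of month m, and listing them in this order gives a
-- duplicate-free enumeration. Year a has 365 days plus one if the Gregorian year a + 1 is leap,
-- and the leap rule is inclusion–exclusion over divisibility by 4, 100 and 400; since exactly
-- n / k of the numbers 1, …, n are multiples of k, the years before y have
-- 365 y + y / 4 − y / 100 + y / 400 days. The month term (153 m − 457) / 5 is checked month by month.

open import Defs

module Counting where

  open import Algebra.Properties.CommutativeSemigroup using (interchange)
  open import Data.Bool using (Bool; true; false; if_then_else_; T; _∧_; _∨_; not)
  open import Data.Empty using (⊥-elim)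
  import Data.Integer as ℤ
  open import Data.Nat
  open import Data.Nat.DivMod
  open import Data.Nat.Divisibility using (_∣_; divides; ∣-trans; m%n≡0⇒n∣m; n∣m⇒m%n≡0)
  open import Data.Nat.Properties
  open import Data.Sum using (inj₁; inj₂)
  open import Data.Unit using (tt)
  open import Relation.Binary.PropositionalEquality
  open import Relation.Nullary.Decidable using (⌊_⌋; toWitness; fromWitness)

  sumBelow : (ℕ → ℕ) → ℕ → ℕ
  sumBelow f zero    = 0
  sumBelow f (suc n) = sumBelow f n + f n

  sumBelow-cong : ∀ {f g} → (∀ i → f i ≡ g i) → ∀ n → sumBelow f n ≡ sumBelow g n
  sumBelow-cong f≗g zero    = refl
  sumBelow-cong f≗g (suc n) = cong₂ _+_ (sumBelow-cong f≗g n) (f≗g n)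

  sumBelow-distrib-+ : ∀ f g n → sumBelow (λ i → f i + g i) n ≡ sumBelow f n + sumBelow g n
  sumBelow-distrib-+ f g zero    = refl
  sumBelow-distrib-+ f g (suc n) =
    trans (cong (_+ (f n + g n)) (sumBelow-distrib-+ f g n))
          (interchange +-commutativeSemigroup (sumBelow f n) (sumBelow g n) (f n) (g n))

  sumBelow-const : ∀ c n → sumBelow (λ _ → c) n ≡ c * n
  sumBelow-const c zero    = sym (*-zeroʳ c)
  sumBelow-const c (suc n) =
    trans (cong (_+ c) (sumBelow-const c n)) (trans (+-comm (c * n) c) (sym (*-suc c n)))

  𝟙 : Bool → ℕ
  𝟙 b = if b then 1 else 0

  𝟙[_∣_] : (k m : ℕ) .{{_ : NonZero k}} → ℕ
  𝟙[ k ∣ m ] = 𝟙 ⌊ m % k ≟ 0 ⌋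

  [1+s]/n≡𝟙[n∣1+s] : ∀ {s n} .{{_ : NonZero n}} → suc s ≤ n → suc s / n ≡ 𝟙[ n ∣ suc s ]
  [1+s]/n≡𝟙[n∣1+s] {s} s<n with m≤n⇒m<n∨m≡n s<n
  ... | inj₁ 1+s<n rewrite m<n⇒m/n≡0 1+s<n | m<n⇒m%n≡m 1+s<n = refl
  ... | inj₂ refl  rewrite n%n≡0 (suc s) {{nonZero}} = n/n≡1 (suc s)

  /-suc : ∀ m n .{{_ : NonZero n}} → suc m / n ≡ m / n + 𝟙[ n ∣ suc m ]
  /-suc m n = begin
    suc m / n               ≡⟨ /-congˡ split ⟩
    (suc r + q * n) / n     ≡⟨ +-distrib-/-∣ʳ (suc r) (divides q refl) ⟩
    suc r / n + q * n / n   ≡⟨ cong₂ _+_ ([1+s]/n≡𝟙[n∣1+s] (m%n<n m n)) (m*n/n≡m q n) ⟩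
    𝟙[ n ∣ suc r ] + q      ≡⟨ cong (λ s → 𝟙 ⌊ s ≟ 0 ⌋ + q) (sym [1+m]%n≡[1+r]%n) ⟩
    𝟙[ n ∣ suc m ] + q      ≡⟨ +-comm 𝟙[ n ∣ suc m ] q ⟩
    q + 𝟙[ n ∣ suc m ]      ∎
    where
      open ≡-Reasoning
      q = m / n
      r = m % n
      split : suc m ≡ suc r + q * n
      split = cong suc (m≡m%n+[m/n]*n m n)
      [1+m]%n≡[1+r]%n : suc m % n ≡ suc r % n
      [1+m]%n≡[1+r]%n = trans (%-congˡ split) ([m+kn]%n≡m%n (suc r) q n)

  sumBelow-𝟙[∣] : ∀ k n .{{_ : NonZero k}} → sumBelow (λ i → 𝟙[ k ∣ suc i ]) n ≡ n / k
  sumBelow-𝟙[∣] k zero    = sym (0/n≡0 k)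
  sumBelow-𝟙[∣] k (suc n) = trans (cong (_+ 𝟙[ k ∣ suc n ]) (sumBelow-𝟙[∣] k n)) (sym (/-suc n k))

  𝟙-inclusion-exclusion : ∀ p q r → (T r → T q) → (T q → T p) → 𝟙 ((p ∧ not q) ∨ r) + 𝟙 q ≡ 𝟙 p + 𝟙 r
  𝟙-inclusion-exclusion true  true  true  _   _   = refl
  𝟙-inclusion-exclusion true  true  false _   _   = refl
  𝟙-inclusion-exclusion true  false false _   _   = refl
  𝟙-inclusion-exclusion false false false _   _   = refl
  𝟙-inclusion-exclusion true  false true  r⇒q _   = ⊥-elim (r⇒q tt)
  𝟙-inclusion-exclusion false false true  r⇒q _   = ⊥-elim (r⇒q tt)
  𝟙-inclusion-exclusion false true  _     _   q⇒p = ⊥-elim (q⇒p tt)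

  leap : ℕ → ℕ
  leap m = 𝟙 (isLeap (ℤ.+ m))

  leap+𝟙[100∣]≡𝟙[4∣]+𝟙[400∣] : ∀ m → leap m + 𝟙[ 100 ∣ m ] ≡ 𝟙[ 4 ∣ m ] + 𝟙[ 400 ∣ m ]
  leap+𝟙[100∣]≡𝟙[4∣]+𝟙[400∣] m =
    𝟙-inclusion-exclusion _ _ _ (divisible-by-divisor 100 400 (divides 4 refl)) (divisible-by-divisor 4 100 (divides 25 refl))
    where
      divisible-by-divisor : ∀ k l .{{_ : NonZero k}} .{{_ : NonZero l}} →
                             k ∣ l → T ⌊ m % l ≟ 0 ⌋ → T ⌊ m % k ≟ 0 ⌋
      divisible-by-divisor k l k∣l l∣m =
        fromWitness (n∣m⇒m%n≡0 m k (∣-trans k∣l (m%n≡0⇒n∣m m l (toWitness l∣m))))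

  sumBelow-leap : ∀ n → sumBelow (λ i → leap (suc i)) n + n / 100 ≡ n / 4 + n / 400
  sumBelow-leap n = begin
    sumBelow leap′ n + n / 100                             ≡⟨ cong (sumBelow leap′ n +_) (sym (sumBelow-𝟙[∣] 100 n)) ⟩
    sumBelow leap′ n + sumBelow (λ i → 𝟙[ 100 ∣ suc i ]) n  ≡⟨ sym (sumBelow-distrib-+ leap′ _ n) ⟩
    sumBelow (λ i → leap′ i + 𝟙[ 100 ∣ suc i ]) n
                                                           ≡⟨ sumBelow-cong (λ i → leap+𝟙[100∣]≡𝟙[4∣]+𝟙[400∣] (suc i)) n ⟩
    sumBelow (λ i → 𝟙[ 4 ∣ suc i ] + 𝟙[ 400 ∣ suc i ]) n   ≡⟨ sumBelow-distrib-+ _ _ n ⟩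
    sumBelow (λ i → 𝟙[ 4 ∣ suc i ]) n + sumBelow (λ i → 𝟙[ 400 ∣ suc i ]) n
                                                           ≡⟨ cong₂ _+_ (sumBelow-𝟙[∣] 4 n) (sumBelow-𝟙[∣] 400 n) ⟩
    n / 4 + n / 400                                        ∎
    where
      open ≡-Reasoning
      leap′ : ℕ → ℕ
      leap′ i = leap (suc i)

  -- Month b of computational year a: months 3–12 are March–December of Gregorian year a, months
  -- 13 and 14 are January and February of Gregorian year a + 1. The length is 0 for every other b,
  -- so that c < monthLength a b says exactly that (a, b, c) is a computational date.
  monthLength : ℕ → ℕ → ℕ
  monthLength a 3  = 31
  monthLength a 4  = 30
  monthLength a 5  = 31
  monthLength a 6  = 30
  monthLength a 7  = 31
  monthLength a 8  = 31
  monthLength a 9  = 30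
  monthLength a 10 = 31
  monthLength a 11 = 30
  monthLength a 12 = 31
  monthLength a 13 = 31
  monthLength a 14 = if isLeap (ℤ.+ suc a) then 29 else 28
  monthLength a _  = 0

  yearLength : ℕ → ℕ
  yearLength a = sumBelow (monthLength a) 15

  yearLength≡365+leap : ∀ a → yearLength a ≡ 365 + leap (suc a)
  yearLength≡365+leap a with isLeap (ℤ.+ suc a)
  ... | true  = refl
  ... | false = refl

  sumBelow-yearLength : ∀ n → sumBelow yearLength n + n / 100 ≡ 365 * n + n / 4 + n / 400
  sumBelow-yearLength n = begin
    sumBelow yearLength n + n / 100
      ≡⟨ cong (_+ n / 100) (trans (sumBelow-cong yearLength≡365+leap n) (sumBelow-distrib-+ _ _ n)) ⟩
    sumBelow (λ _ → 365) n + sumBelow (λ i → leap (suc i)) n + n / 100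
      ≡⟨ +-assoc (sumBelow (λ _ → 365) n) _ _ ⟩
    sumBelow (λ _ → 365) n + (sumBelow (λ i → leap (suc i)) n + n / 100)
      ≡⟨ cong₂ _+_ (sumBelow-const 365 n) (sumBelow-leap n) ⟩
    365 * n + (n / 4 + n / 400)
      ≡⟨ sym (+-assoc (365 * n) _ _) ⟩
    365 * n + n / 4 + n / 400 ∎
    where open ≡-Reasoning

module Enumeration {A : Set} where

  open import Data.Empty using (⊥)
  open import Data.List using (List; []; _++_; length)
  open import Data.List.Membership.Propositional using (_∈_)
  open import Data.List.Membership.Propositional.Properties using (∈-++⁺ˡ; ∈-++⁺ʳ; ∈-++⁻)
  open import Data.List.Properties using (length-++)
  open import Data.List.Relation.Unary.AllPairs using ([])
  open import Data.List.Relation.Unary.Unique.Propositional using (Unique)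
  import Data.List.Relation.Unary.Unique.Propositional.Properties as Unique
  open import Data.Nat using (ℕ; zero; suc; _<_; _+_)
  open import Data.Nat.Properties using (m<n⇒m<1+n; m<1+n⇒m<n∨m≡n; <-irrefl; ≤-refl)
  open import Data.Product using (∃-syntax; _×_; _,_)
  open import Data.Sum using (inj₁; inj₂)
  open import Relation.Binary.PropositionalEquality using (_≡_; refl; trans; cong₂)
  open Counting using (sumBelow)

  concatBelow : (ℕ → List A) → ℕ → List A
  concatBelow f zero    = []
  concatBelow f (suc n) = concatBelow f n ++ f n

  module _ (f : ℕ → List A) where

    length-concatBelow : ∀ n → length (concatBelow f n) ≡ sumBelow (λ i → length (f i)) n
    length-concatBelow zero    = refl
    length-concatBelow (suc n) = trans (length-++ (concatBelow f n)) (cong₂ _+_ (length-concatBelow n) refl)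

    ∈-concatBelow⁺ : ∀ {n i x} → i < n → x ∈ f i → x ∈ concatBelow f n
    ∈-concatBelow⁺ {suc n} i<1+n x∈fi with m<1+n⇒m<n∨m≡n i<1+n
    ... | inj₁ i<n  = ∈-++⁺ˡ (∈-concatBelow⁺ i<n x∈fi)
    ... | inj₂ refl = ∈-++⁺ʳ (concatBelow f n) x∈fi

    ∈-concatBelow⁻ : ∀ {n x} → x ∈ concatBelow f n → ∃[ i ] i < n × x ∈ f i
    ∈-concatBelow⁻ {suc n} x∈ with ∈-++⁻ (concatBelow f n) x∈
    ... | inj₂ x∈fn = n , ≤-refl , x∈fn
    ... | inj₁ x∈fs with ∈-concatBelow⁻ x∈fs
    ...   | i , i<n , x∈fi = i , m<n⇒m<1+n i<n , x∈fi

    concatBelow-unique : (∀ i → Unique (f i)) → (∀ {i j x} → x ∈ f i → x ∈ f j → i ≡ j) →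
                         ∀ n → Unique (concatBelow f n)
    concatBelow-unique unique separated zero    = []
    concatBelow-unique unique separated (suc n) =
      Unique.++⁺ (concatBelow-unique unique separated n) (unique n) disjoint
      where
        disjoint : ∀ {x} → x ∈ concatBelow f n × x ∈ f n → ⊥
        disjoint (x∈fs , x∈fn) with ∈-concatBelow⁻ x∈fs
        ... | i , i<n , x∈fi with separated x∈fi x∈fn
        ...   | refl = <-irrefl refl i<n

module Dates where

  open import Data.Empty using (⊥)
  import Data.Integer as ℤ
  open import Data.Integer using (+<+)
  open import Data.List using (List; [_]; _++_; length)
  open import Data.List.Membership.Propositional using (_∈_)
  open import Data.List.Membership.Propositional.Properties using (∈-++⁺ˡ; ∈-++⁺ʳ; ∈-++⁻)
  open import Data.List.Properties using (length-++)
  open import Data.List.Relation.Unary.Any using (here)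
  open import Data.List.Relation.Unary.All using ([])
  open import Data.List.Relation.Unary.AllPairs using ([]; _∷_)
  open import Data.List.Relation.Unary.Unique.Propositional using (Unique)
  import Data.List.Relation.Unary.Unique.Propositional.Properties as Unique
  open import Data.Nat
  open import Data.Nat.Properties
  open import Data.Product using (_×_; _,_; proj₁)
  open import Data.Sum using (inj₁; inj₂; [_,_]′)
  open import Function using (_∘_; case_of_)
  open import Relation.Binary.PropositionalEquality using (_≡_; refl; trans; sym; cong; cong₂; subst; module ≡-Reasoning)
  open import Relation.Nullary using (yes; no; contradiction)
  open Counting using (sumBelow; sumBelow-cong; sumBelow-const; monthLength; yearLength)
  open Enumeration

  ℕ³ : Set
  ℕ³ = ℕ × ℕ × ℕ

  toℤ³ : ℕ³ → ℤ³
  toℤ³ (a , b , c) = (ℤ.+ a , ℤ.+ b , ℤ.+ c)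

  toℤ³-injective : ∀ {s t} → toℤ³ s ≡ toℤ³ t → s ≡ t
  toℤ³-injective {_ , _ , _} {_ , _ , _} refl = refl

  IsDate : ℕ³ → Set
  IsDate (a , b , c) = c < monthLength a b

  IsDate⇒month<15 : ∀ {a b c} → IsDate (a , b , c) → b < 15
  IsDate⇒month<15 {a} {b} {c} isDate with 15 ≤? b
  ... | no 15≰b  = ≰⇒> 15≰b
  ... | yes 15≤b = contradiction (subst (λ b → c < monthLength a b) (sym (m+[n∸m]≡n 15≤b)) isDate) n≮0

  days : ℕ → ℕ → ℕ → List ℕ³
  days a b n = concatBelow (λ c → [ a , b , c ]) n

  monthDays : ℕ → ℕ → List ℕ³
  monthDays a b = days a b (monthLength a b)

  months : ℕ → ℕ → List ℕ³
  months a m = concatBelow (monthDays a) m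

  yearDays : ℕ → List ℕ³
  yearDays a = months a 15

  years : ℕ → List ℕ³
  years n = concatBelow yearDays n

  datesBefore : ℕ³ → List ℕ³
  datesBefore (y , m , d) = years y ++ months y m ++ days y m d

  ∈-days⁺ : ∀ {a b c n} → c < n → (a , b , c) ∈ days a b n
  ∈-days⁺ {a} {b} c<n = ∈-concatBelow⁺ (λ c → [ a , b , c ]) c<n (here refl)

  ∈-days⁻ : ∀ a b n {a′ b′ c} → (a′ , b′ , c) ∈ days a b n → a′ ≡ a × b′ ≡ b × c < n
  ∈-days⁻ a b n s∈ with ∈-concatBelow⁻ (λ c → [ a , b , c ]) s∈
  ... | _ , c<n , here refl = refl , refl , c<n

  ∈-months⁺ : ∀ {a b c m} → b < m → IsDate (a , b , c) → (a , b , c) ∈ months a m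
  ∈-months⁺ {a} b<m isDate = ∈-concatBelow⁺ (monthDays a) b<m (∈-days⁺ isDate)

  ∈-months⁻ : ∀ a m {a′ b c} → (a′ , b , c) ∈ months a m → a′ ≡ a × b < m × IsDate (a′ , b , c)
  ∈-months⁻ a m s∈ with ∈-concatBelow⁻ (monthDays a) s∈
  ... | b , b<m , s∈days with ∈-days⁻ a b (monthLength a b) s∈days
  ...   | refl , refl , isDate = refl , b<m , isDate

  ∈-years⁺ : ∀ {a b c n} → a < n → IsDate (a , b , c) → (a , b , c) ∈ years n
  ∈-years⁺ a<n isDate = ∈-concatBelow⁺ yearDays a<n (∈-months⁺ (IsDate⇒month<15 isDate) isDate)

  ∈-years⁻ : ∀ n {a b c} → (a , b , c) ∈ years n → a < n × IsDate (a , b , c)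
  ∈-years⁻ n s∈ with ∈-concatBelow⁻ yearDays s∈
  ... | a , a<n , s∈months with ∈-months⁻ a 15 s∈months
  ...   | refl , _ , isDate = a<n , isDate

  ∈-datesBefore⁺ : ∀ {s t} → IsDate s → toℤ³ s <ₗ toℤ³ t → s ∈ datesBefore t
  ∈-datesBefore⁺ {t = y , _ , _} isDate (inj₁ (+<+ a<y)) =
    ∈-++⁺ˡ (∈-years⁺ a<y isDate)
  ∈-datesBefore⁺ {t = y , m , _} isDate (inj₂ (refl , inj₁ (+<+ b<m))) =
    ∈-++⁺ʳ (years y) (∈-++⁺ˡ (∈-months⁺ b<m isDate))
  ∈-datesBefore⁺ {t = y , m , _} isDate (inj₂ (refl , inj₂ (refl , +<+ c<d))) =
    ∈-++⁺ʳ (years y) (∈-++⁺ʳ (months y m) (∈-days⁺ c<d))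

  ∈-years⇒<ₗ : ∀ {s y m d} → s ∈ years y → IsDate s × toℤ³ s <ₗ toℤ³ (y , m , d)
  ∈-years⇒<ₗ {_ , _ , _} {y} s∈ = case ∈-years⁻ y s∈ of λ where
    (a<y , isDate) → isDate , inj₁ (+<+ a<y)

  ∈-months⇒<ₗ : ∀ {s y m d} → s ∈ months y m → IsDate s × toℤ³ s <ₗ toℤ³ (y , m , d)
  ∈-months⇒<ₗ {_ , _ , _} {y} {m} s∈ = case ∈-months⁻ y m s∈ of λ where
    (refl , b<m , isDate) → isDate , inj₂ (refl , inj₁ (+<+ b<m))

  ∈-days⇒<ₗ : ∀ {s y m d} → IsDate (y , m , d) → s ∈ days y m d → IsDate s × toℤ³ s <ₗ toℤ³ (y , m , d)
  ∈-days⇒<ₗ {_ , _ , _} {y} {m} {d} isDate s∈ = case ∈-days⁻ y m d s∈ of λ where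
    (refl , refl , c<d) → <-trans c<d isDate , inj₂ (refl , inj₂ (refl , +<+ c<d))

  ∈-datesBefore⁻ : ∀ {s t} → IsDate t → s ∈ datesBefore t → IsDate s × toℤ³ s <ₗ toℤ³ t
  ∈-datesBefore⁻ {t = y , m , d} isDate s∈ =
    [ ∈-years⇒<ₗ , [ ∈-months⇒<ₗ , ∈-days⇒<ₗ isDate ]′ ∘ ∈-++⁻ (months y m) ]′ (∈-++⁻ (years y) s∈)

  days-unique : ∀ a b n → Unique (days a b n)
  days-unique a b = concatBelow-unique (λ c → [ a , b , c ]) (λ _ → [] ∷ []) separated
    where
      separated : ∀ {i j s} → s ∈ [ a , b , i ] → s ∈ [ a , b , j ] → i ≡ j
      separated (here refl) (here refl) = refl

  months-unique : ∀ a m → Unique (months a m)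
  months-unique a = concatBelow-unique (monthDays a) (λ b → days-unique a b (monthLength a b)) separated
    where
      separated : ∀ {i j s} → s ∈ monthDays a i → s ∈ monthDays a j → i ≡ j
      separated {i} {j} {_ , _ , _} s∈ s∈′ =
        case ∈-days⁻ a i (monthLength a i) s∈ , ∈-days⁻ a j (monthLength a j) s∈′ of λ where
          ((_ , refl , _) , (_ , refl , _)) → refl

  years-unique : ∀ n → Unique (years n)
  years-unique = concatBelow-unique yearDays (λ a → months-unique a 15) separated
    where
      separated : ∀ {i j s} → s ∈ yearDays i → s ∈ yearDays j → i ≡ j
      separated {i} {j} {_ , _ , _} s∈ s∈′ = case ∈-months⁻ i 15 s∈ , ∈-months⁻ j 15 s∈′ of λ where
        ((refl , _) , (refl , _)) → refl

  datesBefore-unique : ∀ t → Unique (datesBefore t)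
  datesBefore-unique (y , m , d) =
    Unique.++⁺ (years-unique y) (Unique.++⁺ (months-unique y m) (days-unique y m d) months∩days≡∅) years∩rest≡∅
    where
      months∩days≡∅ : ∀ {s} → s ∈ months y m × s ∈ days y m d → ⊥
      months∩days≡∅ {_ , _ , _} (s∈months , s∈days) = case ∈-months⁻ y m s∈months , ∈-days⁻ y m d s∈days of λ where
        ((_ , b<m , _) , (_ , refl , _)) → <-irrefl refl b<m
      years∩rest≡∅ : ∀ {s} → s ∈ years y × s ∈ months y m ++ days y m d → ⊥
      years∩rest≡∅ {_ , _ , _} (s∈years , s∈rest) =
        <-irrefl ([ proj₁ ∘ ∈-months⁻ y m , proj₁ ∘ ∈-days⁻ y m d ]′ (∈-++⁻ (months y m) s∈rest))
                 (proj₁ (∈-years⁻ y s∈years))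

  length-days : ∀ a b n → length (days a b n) ≡ n
  length-days a b n = trans (length-concatBelow (λ c → [ a , b , c ]) n) (trans (sumBelow-const 1 n) (*-identityˡ n))

  length-months : ∀ a m → length (months a m) ≡ sumBelow (monthLength a) m
  length-months a m = trans (length-concatBelow (monthDays a) m) (sumBelow-cong (λ b → length-days a b _) m)

  length-years : ∀ n → length (years n) ≡ sumBelow yearLength n
  length-years n = trans (length-concatBelow yearDays n) (sumBelow-cong (λ a → length-months a 15) n)

  length-datesBefore : ∀ y m d → length (datesBefore (y , m , d)) ≡ sumBelow yearLength y + sumBelow (monthLength y) m + d
  length-datesBefore y m d = begin
    length (years y ++ months y m ++ days y m d)                     ≡⟨ length-++ (years y) ⟩
    length (years y) + length (months y m ++ days y m d)             ≡⟨ cong (length (years y) +_) (length-++ (months y m)) ⟩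
    length (years y) + (length (months y m) + length (days y m d))   ≡⟨ sym (+-assoc (length (years y)) _ _) ⟩
    length (years y) + length (months y m) + length (days y m d)
      ≡⟨ cong₂ _+_ (cong₂ _+_ (length-years y) (length-months y m)) (length-days y m d) ⟩
    sumBelow yearLength y + sumBelow (monthLength y) m + d           ∎
    where open ≡-Reasoning

open import Data.Bool using (true; false)
open import Data.Integer using (ℤ; +_; -[1+_]; _+_; _-_; _*_; _/_; _≤_; _≤?_; +≤+; +<+; drop‿+≤+)
open import Data.Integer.DivMod using (div-pos-is-/ℕ)
import Data.Integer.Properties as ℤ
open import Data.Integer.Tactic.RingSolver using (solve-∀)
open import Data.List using (map; length)
open import Data.List.Membership.Propositional using (_∈_)
open import Data.List.Membership.Propositional.Properties using (∈-map⁺; ∈-map⁻)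
open import Data.List.Properties using (length-map)
import Data.List.Relation.Unary.Unique.Propositional.Properties as Unique
open import Data.Nat as ℕ using (ℕ; suc; s≤s; z≤n)
open import Data.Nat.Properties using (≤-trans; m≤n⇒m<n∨m≡n; ≤ᵇ⇒≤; ≤⇒≯; <⇒≱; m≤m+n)
open import Data.Product using (∃-syntax; _×_; _,_)
open import Data.Sum using (inj₁; inj₂)
open import Function using (case_of_)
open import Function.Bundles using (_⇔_; mk⇔)
open import Relation.Binary.PropositionalEquality
open import Relation.Nullary using (yes; no; contradiction)
open Counting using (monthLength; sumBelow; yearLength; sumBelow-yearLength)
open Dates

pattern 13+_ k = suc (suc (suc (suc (suc (suc (suc (suc (suc (suc (suc (suc (suc k))))))))))))
pattern 15+_ k = suc (suc (13+ k))

L-February : ∀ a → L (+ suc a) (+ 2) ≡ + monthLength a 14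
L-February a with isLeap (+ suc a)
... | true  = refl
... | false = refl

e₀≤ : ∀ {a b c} → 3 ℕ.≤ b → e₀ ≤ₗ toℤ³ (a , b , c)
e₀≤ {suc a} _   = inj₁ (inj₁ (+<+ (s≤s z≤n)))
e₀≤ {0} 3≤b with m≤n⇒m<n∨m≡n 3≤b
e₀≤ {0}           3≤b | inj₁ 3<b = inj₁ (inj₂ (refl , inj₁ (+<+ 3<b)))
e₀≤ {0} {c = 0}     3≤b | inj₂ refl = inj₂ refl
e₀≤ {0} {c = suc c} 3≤b | inj₂ refl = inj₁ (inj₂ (refl , inj₂ (refl , +<+ (s≤s z≤n))))

P₁-unshifted : ∀ {a b c} → 3 ℕ.≤ b → P₁ (+ a , + b , + suc c) ≡ toℤ³ (a , b , c)
P₁-unshifted {a} {b} {c} 3≤b with + b ≤? + 2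
... | yes (+≤+ b≤2) = contradiction 3≤b (≤⇒≯ b≤2)
... | no _          = cong₂ _,_ (ℤ.+-identityʳ (+ a)) (cong (_, + c) (ℤ.+-identityʳ (+ b)))

G₀-intro : ∀ {z} x → G x → P₁ x ≡ z → e₀ ≤ₗ z → G₀ z
G₀-intro x x∈G refl e₀≤z = x , x∈G , refl , e₀≤z

G₀⇒e₀≤ : ∀ {z} → G₀ z → e₀ ≤ₗ z
G₀⇒e₀≤ (_ , _ , refl , e₀≤z) = e₀≤z

unshifted-date∈G₀ : ∀ {a b c} → 3 ℕ.≤ b → b ℕ.≤ 12 → + suc c ≤ L (+ a) (+ b) → G₀ (toℤ³ (a , b , c))
unshifted-date∈G₀ {a} {b} {c} 3≤b b≤12 day≤L =
  G₀-intro (+ a , + b , + suc c) ((+≤+ (≤-trans (s≤s z≤n) 3≤b) , +≤+ b≤12) , (+≤+ (s≤s z≤n) , day≤L))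
           (P₁-unshifted 3≤b) (e₀≤ 3≤b)

IsDate⇒G₀ : ∀ {t} → IsDate t → G₀ (toℤ³ t)
IsDate⇒G₀ {a , 3  , c} c<ℓ = unshifted-date∈G₀ (≤ᵇ⇒≤ _ _ _) (≤ᵇ⇒≤ _ _ _) (+≤+ c<ℓ)
IsDate⇒G₀ {a , 4  , c} c<ℓ = unshifted-date∈G₀ (≤ᵇ⇒≤ _ _ _) (≤ᵇ⇒≤ _ _ _) (+≤+ c<ℓ)
IsDate⇒G₀ {a , 5  , c} c<ℓ = unshifted-date∈G₀ (≤ᵇ⇒≤ _ _ _) (≤ᵇ⇒≤ _ _ _) (+≤+ c<ℓ)
IsDate⇒G₀ {a , 6  , c} c<ℓ = unshifted-date∈G₀ (≤ᵇ⇒≤ _ _ _) (≤ᵇ⇒≤ _ _ _) (+≤+ c<ℓ)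
IsDate⇒G₀ {a , 7  , c} c<ℓ = unshifted-date∈G₀ (≤ᵇ⇒≤ _ _ _) (≤ᵇ⇒≤ _ _ _) (+≤+ c<ℓ)
IsDate⇒G₀ {a , 8  , c} c<ℓ = unshifted-date∈G₀ (≤ᵇ⇒≤ _ _ _) (≤ᵇ⇒≤ _ _ _) (+≤+ c<ℓ)
IsDate⇒G₀ {a , 9  , c} c<ℓ = unshifted-date∈G₀ (≤ᵇ⇒≤ _ _ _) (≤ᵇ⇒≤ _ _ _) (+≤+ c<ℓ)
IsDate⇒G₀ {a , 10 , c} c<ℓ = unshifted-date∈G₀ (≤ᵇ⇒≤ _ _ _) (≤ᵇ⇒≤ _ _ _) (+≤+ c<ℓ)
IsDate⇒G₀ {a , 11 , c} c<ℓ = unshifted-date∈G₀ (≤ᵇ⇒≤ _ _ _) (≤ᵇ⇒≤ _ _ _) (+≤+ c<ℓ)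
IsDate⇒G₀ {a , 12 , c} c<ℓ = unshifted-date∈G₀ (≤ᵇ⇒≤ _ _ _) (≤ᵇ⇒≤ _ _ _) (+≤+ c<ℓ)
IsDate⇒G₀ {a , 13 , c} c<ℓ =
  G₀-intro (+ suc a , + 1 , + suc c) ((+≤+ (s≤s z≤n) , +≤+ (s≤s z≤n)) , (+≤+ (s≤s z≤n) , +≤+ c<ℓ))
           refl (e₀≤ (≤ᵇ⇒≤ _ _ _))
IsDate⇒G₀ {a , 14 , c} c<ℓ =
  G₀-intro (+ suc a , + 2 , + suc c)
           ((+≤+ (s≤s z≤n) , +≤+ (≤ᵇ⇒≤ _ _ _)) , (+≤+ (s≤s z≤n) , subst (+ suc c ≤_) (sym (L-February a)) (+≤+ c<ℓ)))
           refl (e₀≤ (≤ᵇ⇒≤ _ _ _))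
IsDate⇒G₀ {_ , 0     , _} ()
IsDate⇒G₀ {_ , 1     , _} ()
IsDate⇒G₀ {_ , 2     , _} ()
IsDate⇒G₀ {_ , 15+ _ , _} ()

decode-year : ∀ {u b c} → e₀ ≤ₗ (u , + b , + c) → (∀ a → u ≡ + a → IsDate (a , b , c)) →
              ∃[ t ] (u , + b , + c) ≡ toℤ³ t × IsDate t
decode-year (inj₁ (inj₁ (+<+ _)))      isDate = _ , refl , isDate _ refl
decode-year (inj₁ (inj₂ (refl , _)))   isDate = _ , refl , isDate _ refl
decode-year (inj₂ refl)                isDate = _ , refl , isDate _ refl

y-1≡+a⇒y≡+[1+a] : ∀ {y a} → y - + 1 ≡ + a → y ≡ + suc a
y-1≡+a⇒y≡+[1+a] {+ suc _}  refl = refl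
y-1≡+a⇒y≡+[1+a] {+ 0}      ()
y-1≡+a⇒y≡+[1+a] { -[1+ _ ]} ()

G₀⇒IsDate : ∀ {z} → G₀ z → ∃[ t ] z ≡ toℤ³ t × IsDate t
G₀⇒IsDate ((y , + 1  , + suc c) , (_ , _ , day≤L) , refl , e₀≤z) = decode-year e₀≤z (λ _ _ → drop‿+≤+ day≤L)
G₀⇒IsDate ((y , + 2  , + suc c) , (_ , _ , day≤L) , refl , e₀≤z) = decode-year e₀≤z february
  where
    february : ∀ a → y - + 1 ≡ + a → c ℕ.< monthLength a 14
    february a y-1≡a = drop‿+≤+ (subst (+ suc c ≤_) (L-February a)
                                   (subst (λ u → + suc c ≤ L u (+ 2)) (y-1≡+a⇒y≡+[1+a] {y} y-1≡a) day≤L))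
G₀⇒IsDate ((y , + 3  , + suc c) , (_ , _ , day≤L) , refl , e₀≤z) = decode-year e₀≤z (λ _ _ → drop‿+≤+ day≤L)
G₀⇒IsDate ((y , + 4  , + suc c) , (_ , _ , day≤L) , refl , e₀≤z) = decode-year e₀≤z (λ _ _ → drop‿+≤+ day≤L)
G₀⇒IsDate ((y , + 5  , + suc c) , (_ , _ , day≤L) , refl , e₀≤z) = decode-year e₀≤z (λ _ _ → drop‿+≤+ day≤L)
G₀⇒IsDate ((y , + 6  , + suc c) , (_ , _ , day≤L) , refl , e₀≤z) = decode-year e₀≤z (λ _ _ → drop‿+≤+ day≤L)
G₀⇒IsDate ((y , + 7  , + suc c) , (_ , _ , day≤L) , refl , e₀≤z) = decode-year e₀≤z (λ _ _ → drop‿+≤+ day≤L)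
G₀⇒IsDate ((y , + 8  , + suc c) , (_ , _ , day≤L) , refl , e₀≤z) = decode-year e₀≤z (λ _ _ → drop‿+≤+ day≤L)
G₀⇒IsDate ((y , + 9  , + suc c) , (_ , _ , day≤L) , refl , e₀≤z) = decode-year e₀≤z (λ _ _ → drop‿+≤+ day≤L)
G₀⇒IsDate ((y , + 10 , + suc c) , (_ , _ , day≤L) , refl , e₀≤z) = decode-year e₀≤z (λ _ _ → drop‿+≤+ day≤L)
G₀⇒IsDate ((y , + 11 , + suc c) , (_ , _ , day≤L) , refl , e₀≤z) = decode-year e₀≤z (λ _ _ → drop‿+≤+ day≤L)
G₀⇒IsDate ((y , + 12 , + suc c) , (_ , _ , day≤L) , refl , e₀≤z) = decode-year e₀≤z (λ _ _ → drop‿+≤+ day≤L)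
G₀⇒IsDate ((_ , + 0     , _) , ((+≤+ () , _) , _) , _)
G₀⇒IsDate ((_ , + 13+ k , _) , ((_ , +≤+ k≤12) , _) , _) = contradiction k≤12 (<⇒≱ (m≤m+n 13 k))
G₀⇒IsDate ((_ , -[1+ _ ] , _) , ((() , _) , _) , _)
G₀⇒IsDate ((_ , + _ , + 0)      , (_ , (+≤+ () , _)) , _)
G₀⇒IsDate ((_ , + _ , -[1+ _ ]) , (_ , (() , _)) , _)

+m≡+[m+n]-+n : ∀ m n → + m ≡ + (m ℕ.+ n) - + n
+m≡+[m+n]-+n m n = trans (x≡x+y-y (+ m) (+ n)) (cong (_- + n) (sym (ℤ.pos-+ m n)))
  where
    x≡x+y-y : ∀ x y → x ≡ x + y - y
    x≡x+y-y = solve-∀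

sumBelow-yearLength-ℤ : ∀ n → + sumBelow yearLength n ≡ + 365 * + n + + n / + 4 - + n / + 100 + + n / + 400
sumBelow-yearLength-ℤ n = begin
  + sumBelow yearLength n                                   ≡⟨ +m≡+[m+n]-+n _ (n ℕ./ 100) ⟩
  + (sumBelow yearLength n ℕ.+ n ℕ./ 100) - + (n ℕ./ 100)    ≡⟨ cong (λ x → + x - + (n ℕ./ 100)) (sumBelow-yearLength n) ⟩
  + (365 ℕ.* n ℕ.+ n ℕ./ 4 ℕ.+ n ℕ./ 400) - + (n ℕ./ 100)    ≡⟨ cong (_- + (n ℕ./ 100)) +-homo ⟩
  + 365 * + n + + (n ℕ./ 4) + + (n ℕ./ 400) - + (n ℕ./ 100)  ≡⟨ rearrange (+ 365 * + n) _ _ _ ⟩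
  + 365 * + n + + (n ℕ./ 4) - + (n ℕ./ 100) + + (n ℕ./ 400)
    ≡⟨ sym (cong₂ (λ x y → + 365 * + n + x - y + + (n ℕ./ 400)) (/-pos 4) (/-pos 100)) ⟩
  + 365 * + n + + n / + 4 - + n / + 100 + + (n ℕ./ 400)
    ≡⟨ sym (cong (λ x → + 365 * + n + + n / + 4 - + n / + 100 + x) (/-pos 400)) ⟩
  + 365 * + n + + n / + 4 - + n / + 100 + + n / + 400       ∎
  where
    open ≡-Reasoning
    /-pos : ∀ k .{{_ : ℕ.NonZero k}} → + n / + k ≡ + (n ℕ./ k)
    /-pos k = div-pos-is-/ℕ (+ n) k
    +-homo : + (365 ℕ.* n ℕ.+ n ℕ./ 4 ℕ.+ n ℕ./ 400) ≡ + 365 * + n + + (n ℕ./ 4) + + (n ℕ./ 400)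
    +-homo = begin
      + (365 ℕ.* n ℕ.+ n ℕ./ 4 ℕ.+ n ℕ./ 400)     ≡⟨ ℤ.pos-+ _ (n ℕ./ 400) ⟩
      + (365 ℕ.* n ℕ.+ n ℕ./ 4) + + (n ℕ./ 400)   ≡⟨ cong (_+ + (n ℕ./ 400)) (ℤ.pos-+ _ (n ℕ./ 4)) ⟩
      + (365 ℕ.* n) + + (n ℕ./ 4) + + (n ℕ./ 400) ≡⟨ cong (λ x → x + + (n ℕ./ 4) + + (n ℕ./ 400)) (ℤ.pos-* 365 n) ⟩
      + 365 * + n + + (n ℕ./ 4) + + (n ℕ./ 400)   ∎
    rearrange : ∀ x a b c → x + a + b - c ≡ x + a - c + b
    rearrange = solve-∀

sumBelow-monthLength-ℤ : ∀ a m {d} → IsDate (a , m , d) → + sumBelow (monthLength a) m ≡ (+ 153 * + m - + 457) / + 5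
sumBelow-monthLength-ℤ _ 3  _ = refl
sumBelow-monthLength-ℤ _ 4  _ = refl
sumBelow-monthLength-ℤ _ 5  _ = refl
sumBelow-monthLength-ℤ _ 6  _ = refl
sumBelow-monthLength-ℤ _ 7  _ = refl
sumBelow-monthLength-ℤ _ 8  _ = refl
sumBelow-monthLength-ℤ _ 9  _ = refl
sumBelow-monthLength-ℤ _ 10 _ = refl
sumBelow-monthLength-ℤ _ 11 _ = refl
sumBelow-monthLength-ℤ _ 12 _ = refl
sumBelow-monthLength-ℤ _ 13 _ = refl
sumBelow-monthLength-ℤ _ 14 _ = refl
sumBelow-monthLength-ℤ _ 0     ()
sumBelow-monthLength-ℤ _ 1     ()
sumBelow-monthLength-ℤ _ 2     ()
sumBelow-monthLength-ℤ _ (15+ _) ()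

length-datesBefore-ℤ : ∀ y m d → IsDate (y , m , d) →
  + length (datesBefore (y , m , d)) ≡
  (+ 365 * + y + + y / + 4 - + y / + 100 + + y / + 400) + ((+ 153 * + m - + 457) / + 5) + + d
length-datesBefore-ℤ y m d isDate = begin
  + length (datesBefore (y , m , d))                                      ≡⟨ cong +_ (length-datesBefore y m d) ⟩
  + (sumBelow yearLength y ℕ.+ sumBelow (monthLength y) m ℕ.+ d)          ≡⟨ ℤ.pos-+ _ d ⟩
  + (sumBelow yearLength y ℕ.+ sumBelow (monthLength y) m) + + d          ≡⟨ cong (_+ + d) (ℤ.pos-+ (sumBelow yearLength y) _) ⟩
  + sumBelow yearLength y + + sumBelow (monthLength y) m + + d
    ≡⟨ cong₂ (λ u v → u + v + + d) (sumBelow-yearLength-ℤ y) (sumBelow-monthLength-ℤ y m isDate) ⟩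
  (+ 365 * + y + + y / + 4 - + y / + 100 + + y / + 400) + ((+ 153 * + m - + 457) / + 5) + + d ∎
  where open ≡-Reasoning

∈-map-datesBefore⇔ρ₀-set : ∀ {t} → IsDate t → ∀ z → z ∈ map toℤ³ (datesBefore t) ⇔ ρ₀-set (toℤ³ t) z
∈-map-datesBefore⇔ρ₀-set {t} isDate-t z = mk⇔ to from
  where
    to : z ∈ map toℤ³ (datesBefore t) → ρ₀-set (toℤ³ t) z
    to z∈ = case ∈-map⁻ toℤ³ z∈ of λ where
      (s , s∈ , refl) → let isDate-s , s<t = ∈-datesBefore⁻ isDate-t s∈
                        in IsDate⇒G₀ isDate-s , G₀⇒e₀≤ (IsDate⇒G₀ isDate-s) , s<t
    from : ρ₀-set (toℤ³ t) z → z ∈ map toℤ³ (datesBefore t)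
    from (z∈G₀ , _ , z<t) = case G₀⇒IsDate z∈G₀ of λ where
      (s , refl , isDate-s) → ∈-map⁺ toℤ³ (∈-datesBefore⁺ isDate-s z<t)

ρ₀-set-hasCard : ∀ {t} → IsDate t → HasCard (ρ₀-set (toℤ³ t)) (+ length (datesBefore t))
ρ₀-set-hasCard {t} isDate =
  map toℤ³ (datesBefore t) ,
  Unique.map⁺ toℤ³-injective (datesBefore-unique t) ,
  ∈-map-datesBefore⇔ρ₀-set isDate ,
  cong +_ (length-map toℤ³ (datesBefore t))

proposition1 : (y₀ m₀ d₀ : ℤ) → G₀ (y₀ , m₀ , d₀) →
    HasCard (ρ₀-set (y₀ , m₀ , d₀))
      ((+ 365 * y₀ + y₀ / + 4 - y₀ / + 100 + y₀ / + 400) + ((+ 153 * m₀ - + 457) / + 5) + d₀)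
proposition1 y₀ m₀ d₀ z∈G₀ with G₀⇒IsDate z∈G₀
... | (y , m , d) , refl , isDate =
  subst (HasCard (ρ₀-set (+ y , + m , + d))) (length-datesBefore-ℤ y m d isDate) (ρ₀-set-hasCard isDate)
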